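{- Let $G$ be a bipartite graph with vertex classes $A$ and $B$ satisfying $\Delta(G)\leq k^7$, $d(G)\geq k/4$, and $d_G(v)\leq k$ for each $v\in A$. If $k$ is sufficiently large, then $G$ contains a subgraph with maximum degree at most $k$ and average degree at least $k/(400\log k)$.
   Context: $d(G)=2e(G)/|V(G)|$ is the average degree, $\Delta(G)$ the maximum degree and $d_G(v)$ the degree of $v$ in $G$. -}

module Defs where

open import Data.Nat using (ℕ; zero; suc; _+_; _*_; _^_; _≤_; _<_; _!)

open import Data.Bool using (Bool; true; false; if_then_else_; _≟_)
open import Data.Fin using (Fin; zero; suc)
open import Data.Product using (_×_)
open import Relation.Binary.PropositionalEquality using (_≡_; _≢_)

sumFin : (n : ℕ) → (Fin n → ℕ) → ℕ
sumFin zero    f = 0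
sumFin (suc n) f = f zero + sumFin n (λ i → f (suc i))

𝟙 : Bool → ℕ
𝟙 b = if b then 1 else 0

record Graph (n : ℕ) : Set where
  field
    adj   : Fin n → Fin n → Bool
    sym   : ∀ u v → adj u v ≡ adj v u
    irrefl : ∀ v → adj v v ≡ false
open Graph public

deg : ∀ {n} → Graph n → Fin n → ℕ
deg {n} G v = sumFin n (λ w → 𝟙 (adj G v w))

degSum : ∀ {n} → Graph n → ℕ
degSum {n} G = sumFin n (deg G)

-- G is bipartite with vertex classes A = {v | side v ≡ true} and
-- B = {v | side v ≡ false}: every edge joins A and B.
IsBipartition : ∀ {n} → Graph n → (Fin n → Bool) → Set
IsBipartition G side = ∀ u v → adj G u v ≡ true → side u ≢ side v

card : ∀ {n} → (Fin n → Bool) → ℕ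
card {n} S = sumFin n (λ v → 𝟙 (S v))

IsSubgraph : ∀ {n} → Graph n → (Fin n → Bool) → Graph n → Set
IsSubgraph G S H =
  ∀ u v → adj H u v ≡ true → (adj G u v ≡ true) × (S u ≡ true) × (S v ≡ true)

-- expPartial a N = N! · Σ_{i ≤ N} a^i / i!   (a natural number)
expPartial : ℕ → ℕ → ℕ
expPartial a zero    = 1
expPartial a (suc N) = suc N * expPartial a N + a ^ suc N

-- LnGe k a b  means  ln k ≥ a / b  (natural logarithm), with b > 0.
-- ln k ≥ a/b  ⇔  k^b ≥ e^a  ⇔  ∀ N, Σ_{i≤N} a^i/i! ≤ k^b
-- (partial sums of the exponential series increase to e^a).
LnGe : ℕ → ℕ → ℕ → Set
LnGe k a b = (0 < b) × (∀ N → expPartial a N ≤ k ^ b * N !)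

module Submission where

-- Split B into dyadic degree classes: B₀ = {d ≤ k} and B_t = {k 2^(t-1) < d ≤ k 2^t}.
-- Since Δ ≤ k⁷ there are only O(log k) classes, so one of them, B_t, carries a
-- 1/O(log k) share of the edges measured against k (|A| + 2^(t+1) |B_t|).
-- Colour A randomly with m = 2^(t+1) colours and, for each colour j, take A_j ∪ B_t,
-- dropping the B-vertices with more than k neighbours in A_j. A vertex of B_t has
-- about d/m ≤ k/2 neighbours of each colour, and a second-moment bound shows that on
-- average at least 3/8 of its edges survive. Averaging over colourings and colours
-- gives a colour class with k |S| < (64 p + 33) · 2e(H) where 2^p ≈ k, and the crude
-- bound Σ a^i/i! ≤ 2 · 16^a turns this into ln k ≥ k |S| / (400 · 2e(H)).
-- Expectations over colourings are written as sums over all m^n maps Fin n → Fin m.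

open import Defs hiding (sym)
open import Data.Bool using (Bool; true; false; _∧_; _∨_; not; if_then_else_; T)
open import Data.Bool.Properties using (∧-comm; ∧-identityʳ; ∧-zeroʳ; ∧-conicalˡ; ∧-conicalʳ; T-≡)
open import Data.Empty using (⊥-elim)
open import Data.Fin using (Fin; zero; suc; toℕ)
open import Data.Nat
  using (ℕ; zero; suc; _+_; _*_; _^_; _≤_; _<_; z≤n; s≤s; z<s; _≤ᵇ_; _<ᵇ_; _!; NonZero; >-nonZero; _≤?_; ⌊_/2⌋; ⌈_/2⌉)
open import Data.Nat.Properties
open import Data.Nat.Tactic.RingSolver using (solve-∀)
open import Data.Product using (Σ; _×_; _,_; proj₁; proj₂)
open import Data.Sum using (inj₁; inj₂)
open import Function.Bundles using (module Equivalence)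
open Equivalence using (to; from)
open import Relation.Binary.PropositionalEquality
open import Relation.Nullary using (yes; no)

𝟙≤1 : ∀ b → 𝟙 b ≤ 1
𝟙≤1 true  = ≤-refl
𝟙≤1 false = z≤n

𝟙-∧ : ∀ a b → 𝟙 (a ∧ b) ≡ 𝟙 a * 𝟙 b
𝟙-∧ true  b = sym (+-identityʳ (𝟙 b))
𝟙-∧ false b = refl

𝟙-∧-≤ˡ : ∀ a b → 𝟙 (a ∧ b) ≤ 𝟙 a
𝟙-∧-≤ˡ true  b = 𝟙≤1 b
𝟙-∧-≤ˡ false b = z≤n

𝟙-idem : ∀ b → 𝟙 b * 𝟙 b ≡ 𝟙 b
𝟙-idem true  = refl
𝟙-idem false = refl

𝟙+𝟙-not : ∀ b → 𝟙 b + 𝟙 (not b) ≡ 1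
𝟙+𝟙-not true  = refl
𝟙+𝟙-not false = refl

𝟙-positive : ∀ {b} → 0 < 𝟙 b → b ≡ true
𝟙-positive {true} _ = refl

𝟙-split : ∀ b x → 𝟙 b * x + 𝟙 (not b) * x ≡ x
𝟙-split b x = trans (sym (*-distribʳ-+ x (𝟙 b) (𝟙 (not b)))) (trans (cong (_* x) (𝟙+𝟙-not b)) (*-identityˡ x))

𝟙-if : ∀ b x y → 𝟙 (if b then x else y) ≡ 𝟙 (b ∧ x) + 𝟙 (not b ∧ y)
𝟙-if true  x y = sym (+-identityʳ (𝟙 x))
𝟙-if false x y = refl

𝟙*-mono : ∀ b {x y} → (b ≡ true → x ≤ y) → 𝟙 b * x ≤ 𝟙 b * y
𝟙*-mono true  x≤y = +-monoˡ-≤ 0 (x≤y refl)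
𝟙*-mono false x≤y = z≤n

𝟙*-cong : ∀ b {x y} → (b ≡ true → x ≡ y) → 𝟙 b * x ≡ 𝟙 b * y
𝟙*-cong true  x≡y = cong (_+ 0) (x≡y refl)
𝟙*-cong false x≡y = refl

sumFin-cong : ∀ n {f g : Fin n → ℕ} → (∀ i → f i ≡ g i) → sumFin n f ≡ sumFin n g
sumFin-cong zero    f≡g = refl
sumFin-cong (suc n) f≡g = cong₂ _+_ (f≡g zero) (sumFin-cong n (λ i → f≡g (suc i)))

sumFin-mono : ∀ n {f g : Fin n → ℕ} → (∀ i → f i ≤ g i) → sumFin n f ≤ sumFin n g
sumFin-mono zero    f≤g = z≤n
sumFin-mono (suc n) f≤g = +-mono-≤ (f≤g zero) (sumFin-mono n (λ i → f≤g (suc i)))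

sumFin-+ : ∀ n (f g : Fin n → ℕ) → sumFin n (λ i → f i + g i) ≡ sumFin n f + sumFin n g
sumFin-+ zero    f g = refl
sumFin-+ (suc n) f g = begin
  f zero + g zero + sumFin n (λ i → f (suc i) + g (suc i))
    ≡⟨ cong (f zero + g zero +_) (sumFin-+ n (λ i → f (suc i)) (λ i → g (suc i))) ⟩
  f zero + g zero + (sumFin n (λ i → f (suc i)) + sumFin n (λ i → g (suc i)))
    ≡⟨ +-interchange (f zero) (g zero) _ _ ⟩
  f zero + sumFin n (λ i → f (suc i)) + (g zero + sumFin n (λ i → g (suc i))) ∎
  where
  open ≡-Reasoning
  +-interchange : ∀ a b c d → a + b + (c + d) ≡ a + c + (b + d)
  +-interchange = solve-∀

sumFin-*ˡ : ∀ n c (f : Fin n → ℕ) → sumFin n (λ i → c * f i) ≡ c * sumFin n f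
sumFin-*ˡ zero    c f = sym (*-zeroʳ c)
sumFin-*ˡ (suc n) c f =
  trans (cong (c * f zero +_) (sumFin-*ˡ n c (λ i → f (suc i)))) (sym (*-distribˡ-+ c (f zero) _))

sumFin-const : ∀ n c → sumFin n (λ _ → c) ≡ n * c
sumFin-const zero    c = refl
sumFin-const (suc n) c = cong (c +_) (sumFin-const n c)

sumFin-zero : ∀ n → sumFin n (λ _ → 0) ≡ 0
sumFin-zero n = trans (sumFin-const n 0) (*-zeroʳ n)

sumFin-swap : ∀ n m (f : Fin n → Fin m → ℕ) →
  sumFin n (λ i → sumFin m (f i)) ≡ sumFin m (λ j → sumFin n (λ i → f i j))
sumFin-swap zero    m f = sym (sumFin-zero m)
sumFin-swap (suc n) m f =
  trans (cong (sumFin m (f zero) +_) (sumFin-swap n m (λ i → f (suc i))))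
        (sym (sumFin-+ m (f zero) _))

sumFin-*-sumFin : ∀ n m (f : Fin n → ℕ) (g : Fin m → ℕ) →
  sumFin n f * sumFin m g ≡ sumFin n (λ i → sumFin m (λ j → f i * g j))
sumFin-*-sumFin zero    m f g = refl
sumFin-*-sumFin (suc n) m f g =
  trans (*-distribʳ-+ (sumFin m g) (f zero) _)
        (cong₂ _+_ (sym (sumFin-*ˡ m (f zero) g)) (sumFin-*-sumFin n m (λ i → f (suc i)) g))

term≤sumFin : ∀ n (f : Fin n → ℕ) i → f i ≤ sumFin n f
term≤sumFin (suc n) f zero    = m≤m+n _ _
term≤sumFin (suc n) f (suc i) = ≤-trans (term≤sumFin n (λ j → f (suc j)) i) (m≤n+m _ _)

sumFin-<⇒∃< : ∀ n (f g : Fin n → ℕ) → sumFin n f < sumFin n g → Σ (Fin n) λ i → f i < g i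
sumFin-<⇒∃< zero    f g ()
sumFin-<⇒∃< (suc n) f g Σf<Σg with f zero <? g zero
... | yes f₀<g₀ = zero , f₀<g₀
... | no  f₀≮g₀ =
  let (i , fi<gi) = sumFin-<⇒∃< n (λ i → f (suc i)) (λ i → g (suc i))
        (+-cancelˡ-< (g zero) _ _ (≤-<-trans (+-monoˡ-≤ _ (≮⇒≥ f₀≮g₀)) Σf<Σg))
  in suc i , fi<gi

sumTo : ℕ → (ℕ → ℕ) → ℕ
sumTo T g = sumFin T (λ i → g (toℕ i))

sumTo-suc : ∀ T g → sumTo (suc T) g ≡ sumTo T g + g T
sumTo-suc zero    g = +-comm (g 0) 0
sumTo-suc (suc T) g = trans (cong (g 0 +_) (sumTo-suc T (λ t → g (suc t)))) (sym (+-assoc (g 0) _ _))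

sumTo-<⇒∃< : ∀ T (f g : ℕ → ℕ) → sumTo T f < sumTo T g → Σ ℕ λ t → f t < g t
sumTo-<⇒∃< T f g Σf<Σg = let (i , fi<gi) = sumFin-<⇒∃< T _ _ Σf<Σg in toℕ i , fi<gi

sumTo-2^ : ∀ T → sumTo T (2 ^_) < 2 ^ T
sumTo-2^ zero    = s≤s z≤n
sumTo-2^ (suc T) = begin-strict
  sumTo (suc T) (2 ^_)   ≡⟨ sumTo-suc T (2 ^_) ⟩
  sumTo T (2 ^_) + 2 ^ T <⟨ +-monoˡ-< (2 ^ T) (sumTo-2^ T) ⟩
  2 ^ T + 2 ^ T          ≡⟨ cong (2 ^ T +_) (sym (+-identityʳ (2 ^ T))) ⟩
  2 ^ suc T              ∎
  where open ≤-Reasoning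

_==_ : ∀ {m} → Fin m → Fin m → Bool
zero  == zero  = true
zero  == suc _ = false
suc _ == zero  = false
suc x == suc y = x == y

==-refl : ∀ {m} (x : Fin m) → (x == x) ≡ true
==-refl zero    = refl
==-refl (suc x) = ==-refl x

==-sym : ∀ {m} (x y : Fin m) → (x == y) ≡ (y == x)
==-sym zero    zero    = refl
==-sym zero    (suc y) = refl
==-sym (suc x) zero    = refl
==-sym (suc x) (suc y) = ==-sym x y

==⇒≡ : ∀ {m} (x y : Fin m) → (x == y) ≡ true → x ≡ y
==⇒≡ zero    zero    _ = refl
==⇒≡ (suc x) (suc y) h = cong suc (==⇒≡ x y h)

sumFin-δ : ∀ m (x : Fin m) (g : Fin m → ℕ) → sumFin m (λ j → 𝟙 (x == j) * g j) ≡ g x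
sumFin-δ (suc m) zero    g = begin
  g zero + 0 + sumFin m (λ _ → 0) ≡⟨ cong (g zero + 0 +_) (sumFin-zero m) ⟩
  g zero + 0 + 0                  ≡⟨ cong (_+ 0) (+-identityʳ (g zero)) ⟩
  g zero + 0                      ≡⟨ +-identityʳ (g zero) ⟩
  g zero                          ∎
  where open ≡-Reasoning
sumFin-δ (suc m) (suc x) g = sumFin-δ m x (λ j → g (suc j))

sumFin-δ-count : ∀ m (x : Fin m) → sumFin m (λ j → 𝟙 (x == j)) ≡ 1
sumFin-δ-count m x = trans (sumFin-cong m (λ j → sym (*-identityʳ _))) (sumFin-δ m x (λ _ → 1))

cons : ∀ {n m} → Fin m → (Fin n → Fin m) → Fin (suc n) → Fin m
cons c g zero    = c
cons c g (suc i) = g i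

sumMaps : ∀ n m → ((Fin n → Fin m) → ℕ) → ℕ
sumMaps zero    m F = F (λ ())
sumMaps (suc n) m F = sumFin m (λ c → sumMaps n m (λ g → F (cons c g)))

sumMaps-cong : ∀ n m {F G : (Fin n → Fin m) → ℕ} → (∀ f → F f ≡ G f) → sumMaps n m F ≡ sumMaps n m G
sumMaps-cong zero    m F≡G = F≡G _
sumMaps-cong (suc n) m F≡G = sumFin-cong m (λ c → sumMaps-cong n m (λ g → F≡G (cons c g)))

sumMaps-mono : ∀ n m {F G : (Fin n → Fin m) → ℕ} → (∀ f → F f ≤ G f) → sumMaps n m F ≤ sumMaps n m G
sumMaps-mono zero    m F≤G = F≤G _
sumMaps-mono (suc n) m F≤G = sumFin-mono m (λ c → sumMaps-mono n m (λ g → F≤G (cons c g)))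

sumMaps-+ : ∀ n m (F G : (Fin n → Fin m) → ℕ) →
  sumMaps n m (λ f → F f + G f) ≡ sumMaps n m F + sumMaps n m G
sumMaps-+ zero    m F G = refl
sumMaps-+ (suc n) m F G =
  trans (sumFin-cong m (λ c → sumMaps-+ n m (λ g → F (cons c g)) (λ g → G (cons c g)))) (sumFin-+ m _ _)

sumMaps-*ˡ : ∀ n m c (F : (Fin n → Fin m) → ℕ) → sumMaps n m (λ f → c * F f) ≡ c * sumMaps n m F
sumMaps-*ˡ zero    m c F = refl
sumMaps-*ˡ (suc n) m c F =
  trans (sumFin-cong m (λ d → sumMaps-*ˡ n m c (λ g → F (cons d g)))) (sumFin-*ˡ m c _)

sumMaps-const : ∀ n m c → sumMaps n m (λ _ → c) ≡ m ^ n * c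
sumMaps-const zero    m c = sym (+-identityʳ c)
sumMaps-const (suc n) m c =
  trans (sumFin-cong m (λ _ → sumMaps-const n m c))
        (trans (sumFin-const m _) (sym (*-assoc m (m ^ n) c)))

sumMaps-sumFin : ∀ n m k (F : (Fin n → Fin m) → Fin k → ℕ) →
  sumMaps n m (λ f → sumFin k (F f)) ≡ sumFin k (λ i → sumMaps n m (λ f → F f i))
sumMaps-sumFin zero    m k F = refl
sumMaps-sumFin (suc n) m k F =
  trans (sumFin-cong m (λ c → sumMaps-sumFin n m k (λ g → F (cons c g)))) (sumFin-swap m k _)

sumMaps-<⇒∃< : ∀ n m (F G : (Fin n → Fin m) → ℕ) →
  sumMaps n m F < sumMaps n m G → Σ (Fin n → Fin m) λ f → F f < G f
sumMaps-<⇒∃< zero    m F G ΣF<ΣG = _ , ΣF<ΣG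
sumMaps-<⇒∃< (suc n) m F G ΣF<ΣG =
  let (c , <c) = sumFin-<⇒∃< m _ _ ΣF<ΣG
      (g , <g) = sumMaps-<⇒∃< n m (λ g → F (cons c g)) (λ g → G (cons c g)) <c
  in cons c g , <g

sumMaps-eval : ∀ n m (y : Fin n) (G : Fin m → ℕ) →
  m * sumMaps n m (λ f → G (f y)) ≡ m ^ n * sumFin m G
sumMaps-eval (suc n) m zero G = begin
  m * sumFin m (λ c → sumMaps n m (λ _ → G c)) ≡⟨ cong (m *_) (sumFin-cong m (λ c → sumMaps-const n m (G c))) ⟩
  m * sumFin m (λ c → m ^ n * G c)             ≡⟨ cong (m *_) (sumFin-*ˡ m (m ^ n) G) ⟩
  m * (m ^ n * sumFin m G)                     ≡⟨ sym (*-assoc m _ _) ⟩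
  m ^ suc n * sumFin m G                       ∎
  where open ≡-Reasoning
sumMaps-eval (suc n) m (suc y) G = begin
  m * sumFin m (λ c → sumMaps n m (λ g → G (g y))) ≡⟨ sym (sumFin-*ˡ m m _) ⟩
  sumFin m (λ c → m * sumMaps n m (λ g → G (g y))) ≡⟨ sumFin-cong m (λ _ → sumMaps-eval n m y G) ⟩
  sumFin m (λ c → m ^ n * sumFin m G)             ≡⟨ sumFin-const m _ ⟩
  m * (m ^ n * sumFin m G)                         ≡⟨ sym (*-assoc m _ _) ⟩
  m ^ suc n * sumFin m G                           ∎
  where open ≡-Reasoning

sumMaps-collision-distinct : ∀ n m (x y : Fin n) → (x == y) ≡ false →
  m * sumMaps n m (λ f → 𝟙 (f x == f y)) ≡ m ^ n
sumMaps-collision-distinct (suc n) m zero (suc y) _ = begin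
  m * sumFin m (λ c → sumMaps n m (λ g → 𝟙 (c == g y))) ≡⟨ sym (sumFin-*ˡ m m _) ⟩
  sumFin m (λ c → m * sumMaps n m (λ g → 𝟙 (c == g y))) ≡⟨ sumFin-cong m (λ c → count c) ⟩
  sumFin m (λ _ → m ^ n)                                ≡⟨ sumFin-const m _ ⟩
  m ^ suc n                                             ∎
  where
  open ≡-Reasoning
  count : ∀ c → m * sumMaps n m (λ g → 𝟙 (c == g y)) ≡ m ^ n
  count c = trans (sumMaps-eval n m y (λ d → 𝟙 (c == d)))
                  (trans (cong (m ^ n *_) (sumFin-δ-count m c)) (*-identityʳ _))
sumMaps-collision-distinct (suc n) m (suc x) zero x≢y =
  trans (cong (m *_) (sumMaps-cong (suc n) m (λ f → cong 𝟙 (==-sym (f (suc x)) (f zero)))))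
        (sumMaps-collision-distinct (suc n) m zero (suc x) (trans (==-sym zero (suc x)) x≢y))
sumMaps-collision-distinct (suc n) m (suc x) (suc y) x≢y = begin
  m * sumFin m (λ c → sumMaps n m (λ g → 𝟙 (g x == g y))) ≡⟨ sym (sumFin-*ˡ m m _) ⟩
  sumFin m (λ c → m * sumMaps n m (λ g → 𝟙 (g x == g y))) ≡⟨ sumFin-cong m (λ _ → sumMaps-collision-distinct n m x y x≢y) ⟩
  sumFin m (λ _ → m ^ n)                                  ≡⟨ sumFin-const m _ ⟩
  m ^ suc n                                               ∎
  where open ≡-Reasoning

sumMaps-collision : ∀ n m (x y : Fin n) →
  m * sumMaps n m (λ f → 𝟙 (f x == f y)) ≤ m ^ n * (m * 𝟙 (x == y) + 1)
sumMaps-collision n m x y with x == y in x=y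
... | false = ≤-reflexive (begin
  m * sumMaps n m (λ f → 𝟙 (f x == f y)) ≡⟨ sumMaps-collision-distinct n m x y x=y ⟩
  m ^ n                                  ≡⟨ reorder m (m ^ n) ⟩
  m ^ n * (m * 0 + 1)                    ∎)
  where
  open ≡-Reasoning
  reorder : ∀ m M → M ≡ M * (m * 0 + 1)
  reorder = solve-∀
... | true rewrite ==⇒≡ x y x=y = begin
  m * sumMaps n m (λ f → 𝟙 (f y == f y)) ≡⟨ cong (m *_) (sumMaps-cong n m (λ f → cong 𝟙 (==-refl (f y)))) ⟩
  m * sumMaps n m (λ _ → 1)              ≡⟨ cong (m *_) (sumMaps-const n m 1) ⟩
  m * (m ^ n * 1)                        ≡⟨ reorder m (m ^ n) ⟩
  m ^ n * (m * 1)                        ≤⟨ *-monoʳ-≤ (m ^ n) (m≤m+n (m * 1) 1) ⟩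
  m ^ n * (m * 1 + 1)                    ∎
  where
  open ≤-Reasoning
  reorder : ∀ m M → m * (M * 1) ≡ M * (m * 1)
  reorder = solve-∀

sumFin-𝟙-∧-== : ∀ m b (c : Fin m) → sumFin m (λ j → 𝟙 (b ∧ (c == j))) ≡ 𝟙 b
sumFin-𝟙-∧-== m b c = begin
  sumFin m (λ j → 𝟙 (b ∧ (c == j)))  ≡⟨ sumFin-cong m (λ j → 𝟙-∧ b _) ⟩
  sumFin m (λ j → 𝟙 b * 𝟙 (c == j))  ≡⟨ sumFin-*ˡ m (𝟙 b) _ ⟩
  𝟙 b * sumFin m (λ j → 𝟙 (c == j))  ≡⟨ cong (𝟙 b *_) (sumFin-δ-count m c) ⟩
  𝟙 b * 1                            ≡⟨ *-identityʳ (𝟙 b) ⟩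
  𝟙 b                                ∎
  where open ≡-Reasoning

^-distribʳ-* : ∀ x y a → (x * y) ^ a ≡ x ^ a * y ^ a
^-distribʳ-* x y zero    = refl
^-distribʳ-* x y (suc a) = trans (cong (x * y *_) (^-distribʳ-* x y a)) (reorder x y (x ^ a) (y ^ a))
  where
  reorder : ∀ x y u v → x * y * (u * v) ≡ x * u * (y * v)
  reorder = solve-∀

!-+-≤ : ∀ i j → (i + j) ! ≤ i ! * (i + j) ^ j
!-+-≤ i zero rewrite +-identityʳ i = ≤-reflexive (sym (*-identityʳ _))
!-+-≤ i (suc j) rewrite +-suc i j = begin
  suc (i + j) * (i + j) !              ≤⟨ *-monoʳ-≤ (suc (i + j)) (!-+-≤ i j) ⟩
  suc (i + j) * (i ! * (i + j) ^ j)    ≤⟨ *-monoʳ-≤ (suc (i + j)) (*-monoʳ-≤ (i !) (^-monoˡ-≤ j (n≤1+n (i + j)))) ⟩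
  suc (i + j) * (i ! * suc (i + j) ^ j) ≡⟨ x*[y*z]≡y*[x*z] (suc (i + j)) (i !) _ ⟩
  i ! * suc (i + j) ^ suc j             ∎
  where
  open ≤-Reasoning
  x*[y*z]≡y*[x*z] : ∀ x y z → x * (y * z) ≡ y * (x * z)
  x*[y*z]≡y*[x*z] = solve-∀

!*^-≤-!-+ : ∀ i j → i ! * i ^ j ≤ (i + j) !
!*^-≤-!-+ i zero rewrite +-identityʳ i = ≤-reflexive (*-identityʳ _)
!*^-≤-!-+ i (suc j) rewrite +-suc i j = begin
  i ! * (i * i ^ j)        ≡⟨ x*[y*z]≡y*[x*z] (i !) i (i ^ j) ⟩
  i * (i ! * i ^ j)        ≤⟨ *-mono-≤ (≤-trans (m≤m+n i j) (n≤1+n (i + j))) (!*^-≤-!-+ i j) ⟩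
  suc (i + j) * (i + j) !  ∎
  where
  open ≤-Reasoning
  x*[y*z]≡y*[x*z] : ∀ x y z → x * (y * z) ≡ y * (x * z)
  x*[y*z]≡y*[x*z] = solve-∀

^*!-≤-^*! : ∀ a i → a ^ i * a ! ≤ a ^ a * i !
^*!-≤-^*! a i with ≤-total i a
... | inj₁ i≤a with j , refl ← m≤n⇒∃[o]m+o≡n i≤a = begin
  (i + j) ^ i * (i + j) !             ≤⟨ *-monoʳ-≤ ((i + j) ^ i) (!-+-≤ i j) ⟩
  (i + j) ^ i * (i ! * (i + j) ^ j)   ≡⟨ reorder ((i + j) ^ i) (i !) ((i + j) ^ j) ⟩
  (i + j) ^ i * (i + j) ^ j * i !     ≡⟨ cong (_* i !) (sym (^-distribˡ-+-* (i + j) i j)) ⟩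
  (i + j) ^ (i + j) * i !             ∎
  where
  open ≤-Reasoning
  reorder : ∀ x y z → x * (y * z) ≡ x * z * y
  reorder = solve-∀
... | inj₂ a≤i with j , refl ← m≤n⇒∃[o]m+o≡n a≤i = begin
  a ^ (a + j) * a !       ≡⟨ cong (_* a !) (^-distribˡ-+-* a a j) ⟩
  a ^ a * a ^ j * a !     ≡⟨ reorder (a ^ a) (a ^ j) (a !) ⟩
  a ^ a * (a ! * a ^ j)   ≤⟨ *-monoʳ-≤ (a ^ a) (!*^-≤-!-+ a j) ⟩
  a ^ a * (a + j) !       ∎
  where
  open ≤-Reasoning
  reorder : ∀ x y z → x * y * z ≡ x * (z * y)
  reorder = solve-∀

suc-^*-≤-^*suc : ∀ n m r → m + r ≡ suc n → suc n ^ m * r ≤ n ^ m * suc n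
suc-^*-≤-^*suc n zero r refl = ≤-refl
suc-^*-≤-^*suc n (suc m) r m+r≡n = begin
  suc n ^ suc m * r          ≡⟨ reorder₁ (suc n) (suc n ^ m) r ⟩
  suc n ^ m * (suc n * r)    ≤⟨ *-monoʳ-≤ (suc n ^ m) sucn*r≤n*sucr ⟩
  suc n ^ m * (n * suc r)    ≡⟨ reorder₂ (suc n ^ m) n (suc r) ⟩
  n * (suc n ^ m * suc r)    ≤⟨ *-monoʳ-≤ n (suc-^*-≤-^*suc n m (suc r) (trans (+-suc m r) m+r≡n)) ⟩
  n * (n ^ m * suc n)        ≡⟨ sym (*-assoc n (n ^ m) (suc n)) ⟩
  n ^ suc m * suc n          ∎
  where
  open ≤-Reasoning
  reorder₁ : ∀ a b r → a * b * r ≡ b * (a * r)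
  reorder₁ = solve-∀
  reorder₂ : ∀ b n s → b * (n * s) ≡ n * (b * s)
  reorder₂ = solve-∀
  r≤n : r ≤ n
  r≤n = ≤-trans (m≤n+m r m) (≤-reflexive (suc-injective m+r≡n))
  sucn*r≤n*sucr : suc n * r ≤ n * suc r
  sucn*r≤n*sucr = subst (suc n * r ≤_) (sym (*-suc n r)) (+-monoˡ-≤ (n * r) r≤n)

suc-^-≤-2*^ : ∀ n m → 2 * m ≤ suc n → suc n ^ m ≤ 2 * n ^ m
suc-^-≤-2*^ n m 2m≤1+n with r , m+r≡1+n ← m≤n⇒∃[o]m+o≡n (≤-trans (m≤m+n m (m + 0)) 2m≤1+n) =
  *-cancelʳ-≤ (suc n ^ m) (2 * n ^ m) r {{>-nonZero r>0}} (begin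
    suc n ^ m * r    ≤⟨ suc-^*-≤-^*suc n m r m+r≡1+n ⟩
    n ^ m * suc n    ≤⟨ *-monoʳ-≤ (n ^ m) 1+n≤2r ⟩
    n ^ m * (2 * r)  ≡⟨ reorder (n ^ m) r ⟩
    2 * n ^ m * r    ∎)
  where
  open ≤-Reasoning
  reorder : ∀ u r → u * (2 * r) ≡ 2 * u * r
  reorder = solve-∀
  m+m≤m+r : m + m ≤ m + r
  m+m≤m+r = subst₂ _≤_ (cong (m +_) (+-identityʳ m)) (sym m+r≡1+n) 2m≤1+n
  1+n≤2r : suc n ≤ 2 * r
  1+n≤2r = begin
    suc n      ≡⟨ sym m+r≡1+n ⟩
    m + r      ≤⟨ +-monoˡ-≤ r (+-cancelˡ-≤ m m r m+m≤m+r) ⟩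
    r + r      ≡⟨ cong (r +_) (sym (+-identityʳ r)) ⟩
    2 * r      ∎
  r>0 : 0 < r
  r>0 = *-cancelˡ-< 2 0 r (<-≤-trans z<s 1+n≤2r)

⌊n/2⌋+⌊n/2⌋≤n : ∀ n → ⌊ n /2⌋ + ⌊ n /2⌋ ≤ n
⌊n/2⌋+⌊n/2⌋≤n zero          = z≤n
⌊n/2⌋+⌊n/2⌋≤n (suc zero)    = z≤n
⌊n/2⌋+⌊n/2⌋≤n (suc (suc n)) =
  s≤s (subst (_≤ suc n) (sym (+-suc ⌊ n /2⌋ ⌊ n /2⌋)) (s≤s (⌊n/2⌋+⌊n/2⌋≤n n)))

-- (1 + 1/n) ^ n ≤ 4, by bounding each half of the exponent by 2.
suc-^-self-≤ : ∀ n → suc n ^ n ≤ 4 * n ^ n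
suc-^-self-≤ n = subst (λ e → suc n ^ e ≤ 4 * n ^ e) (⌊n/2⌋+⌈n/2⌉≡n n) (begin
  suc n ^ (h + h')          ≡⟨ ^-distribˡ-+-* (suc n) h h' ⟩
  suc n ^ h * suc n ^ h'    ≤⟨ *-mono-≤ (suc-^-≤-2*^ n h 2h≤1+n) (suc-^-≤-2*^ n h' 2h'≤1+n) ⟩
  2 * n ^ h * (2 * n ^ h')  ≡⟨ reorder (n ^ h) (n ^ h') ⟩
  4 * (n ^ h * n ^ h')      ≡⟨ cong (4 *_) (sym (^-distribˡ-+-* n h h')) ⟩
  4 * n ^ (h + h')          ∎)
  where
  open ≤-Reasoning
  h h' : ℕ
  h  = ⌊ n /2⌋
  h' = ⌈ n /2⌉
  reorder : ∀ u v → 2 * u * (2 * v) ≡ 4 * (u * v)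
  reorder = solve-∀
  2h≤1+n : 2 * h ≤ suc n
  2h≤1+n = ≤-trans (≤-reflexive (cong (h +_) (+-identityʳ h))) (≤-trans (⌊n/2⌋+⌊n/2⌋≤n n) (n≤1+n n))
  2h'≤1+n : 2 * h' ≤ suc n
  2h'≤1+n = ≤-trans (≤-reflexive (cong (h' +_) (+-identityʳ h'))) (⌊n/2⌋+⌊n/2⌋≤n (suc n))

^-self-≤-4^*! : ∀ a → a ^ a ≤ 4 ^ a * a !
^-self-≤-4^*! zero    = ≤-refl
^-self-≤-4^*! (suc a) = begin
  suc a * suc a ^ a           ≤⟨ *-monoʳ-≤ (suc a) (suc-^-self-≤ a) ⟩
  suc a * (4 * a ^ a)         ≤⟨ *-monoʳ-≤ (suc a) (*-monoʳ-≤ 4 (^-self-≤-4^*! a)) ⟩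
  suc a * (4 * (4 ^ a * a !)) ≡⟨ reorder (suc a) (4 ^ a) (a !) ⟩
  4 * 4 ^ a * (suc a * a !)   ∎
  where
  open ≤-Reasoning
  reorder : ∀ s u f → s * (4 * (u * f)) ≡ 4 * u * (s * f)
  reorder = solve-∀

^-≤-4^*! : ∀ a i → a ^ i ≤ 4 ^ a * i !
^-≤-4^*! a i = *-cancelʳ-≤ (a ^ i) (4 ^ a * i !) (a !) {{a !≢0}} (begin
  a ^ i * a !          ≤⟨ ^*!-≤-^*! a i ⟩
  a ^ a * i !          ≤⟨ *-monoˡ-≤ (i !) (^-self-≤-4^*! a) ⟩
  4 ^ a * a ! * i !    ≡⟨ reorder (4 ^ a) (a !) (i !) ⟩
  4 ^ a * i ! * a !    ∎)
  where
  open ≤-Reasoning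
  reorder : ∀ u g f → u * g * f ≡ u * f * g
  reorder = solve-∀

2^*^-≤-16^*! : ∀ a i → 2 ^ i * a ^ i ≤ 16 ^ a * i !
2^*^-≤-16^*! a i = begin
  2 ^ i * a ^ i   ≡⟨ sym (^-distribʳ-* 2 a i) ⟩
  (2 * a) ^ i     ≤⟨ ^-≤-4^*! (2 * a) i ⟩
  4 ^ (2 * a) * i ! ≡⟨ cong (_* i !) (sym (^-*-assoc 4 2 a)) ⟩
  16 ^ a * i !    ∎
  where open ≤-Reasoning

-- In terms of E = Σ_{i ≤ N} a^i/i! ≤ 16^a (2 − 2^{−N}), cleared of denominators.
expPartial-≤-geometric : ∀ a N → 2 ^ N * expPartial a N + 16 ^ a * N ! ≤ 2 ^ suc N * (16 ^ a * N !)
expPartial-≤-geometric a zero = begin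
  1 * 1 + 16 ^ a * 1  ≡⟨ cong suc (*-identityʳ (16 ^ a)) ⟩
  1 + 16 ^ a          ≤⟨ +-monoˡ-≤ (16 ^ a) (m^n>0 16 a) ⟩
  16 ^ a + 16 ^ a     ≡⟨ reorder (16 ^ a) ⟩
  2 * (16 ^ a * 1)    ∎
  where
  open ≤-Reasoning
  reorder : ∀ u → u + u ≡ 2 * (u * 1)
  reorder = solve-∀
expPartial-≤-geometric a (suc N) = begin
  2 ^ suc N * (suc N * E + a ^ suc N) + Q * (suc N * N !)
    ≡⟨ expand (2 ^ N) E (a ^ suc N) (suc N) Q (N !) ⟩
  2 * suc N * (2 ^ N * E) + (2 ^ suc N * a ^ suc N + suc N * (Q * N !))
    ≤⟨ +-monoʳ-≤ (2 * suc N * (2 ^ N * E)) (+-monoˡ-≤ (suc N * (Q * N !)) (2^*^-≤-16^*! a (suc N))) ⟩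
  2 * suc N * (2 ^ N * E) + (Q * (suc N * N !) + suc N * (Q * N !))
    ≡⟨ collect (suc N) (2 ^ N * E) Q (N !) ⟩
  2 * suc N * (2 ^ N * E + Q * N !)
    ≤⟨ *-monoʳ-≤ (2 * suc N) (expPartial-≤-geometric a N) ⟩
  2 * suc N * (2 * 2 ^ N * (Q * N !))
    ≡⟨ regroup (suc N) (2 ^ N) Q (N !) ⟩
  2 * (2 * 2 ^ N) * (Q * (suc N * N !)) ∎
  where
  open ≤-Reasoning
  E = expPartial a N
  Q = 16 ^ a
  expand : ∀ t E w s Q F → 2 * t * (s * E + w) + Q * (s * F) ≡ 2 * s * (t * E) + (2 * t * w + s * (Q * F))
  expand = solve-∀
  collect : ∀ s x Q F → 2 * s * x + (Q * (s * F) + s * (Q * F)) ≡ 2 * s * (x + Q * F)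
  collect = solve-∀
  regroup : ∀ s t Q F → 2 * s * (2 * t * (Q * F)) ≡ 2 * (2 * t) * (Q * (s * F))
  regroup = solve-∀

expPartial-≤ : ∀ a N → expPartial a N ≤ 2 * 16 ^ a * N !
expPartial-≤ a N = *-cancelˡ-≤ (2 ^ N) {{m^n≢0 2 N}} (begin
  2 ^ N * expPartial a N                      ≤⟨ m≤m+n _ (16 ^ a * N !) ⟩
  2 ^ N * expPartial a N + 16 ^ a * N !        ≤⟨ expPartial-≤-geometric a N ⟩
  2 * 2 ^ N * (16 ^ a * N !)                  ≡⟨ reorder (2 ^ N) (16 ^ a) (N !) ⟩
  2 ^ N * (2 * 16 ^ a * N !)                  ∎)
  where
  open ≤-Reasoning
  reorder : ∀ t Q F → 2 * t * (Q * F) ≡ t * (2 * Q * F)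
  reorder = solve-∀

degSumB : ∀ {n} → Graph n → (Fin n → Bool) → ℕ
degSumB {n} G side = sumFin n (λ v → 𝟙 (not (side v)) * deg G v)

module _ {n} (G : Graph n) (side : Fin n → Bool) (bip : IsBipartition G side) where

  nbr-of-B-in-A : ∀ {v x} → side v ≡ false → adj G v x ≡ true → side x ≡ true
  nbr-of-B-in-A {v} {x} sv≡false vx with side x in sx
  ... | true  = refl
  ... | false = ⊥-elim (bip v x vx (trans sv≡false (sym sx)))

  𝟙-A-end≡𝟙-B-end : ∀ v w → 𝟙 (side v) * 𝟙 (adj G v w) ≡ 𝟙 (not (side w)) * 𝟙 (adj G w v)
  𝟙-A-end≡𝟙-B-end v w rewrite Graph.sym G w v with adj G v w in vw | side v in sv | side w in sw
  ... | false | a     | b     = trans (*-zeroʳ (𝟙 a)) (sym (*-zeroʳ (𝟙 (not b))))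
  ... | true  | true  | false = refl
  ... | true  | false | true  = refl
  ... | true  | true  | true  = ⊥-elim (bip v w vw (trans sv (sym sw)))
  ... | true  | false | false = ⊥-elim (bip v w vw (trans sv (sym sw)))

  degSum≡2*degSumB : degSum G ≡ 2 * degSumB G side
  degSum≡2*degSumB = begin
    sumFin n (deg G)                                                  ≡⟨ sumFin-cong n (λ v → sym (𝟙-split (side v) (deg G v))) ⟩
    sumFin n (λ v → 𝟙 (side v) * deg G v + 𝟙 (not (side v)) * deg G v) ≡⟨ sumFin-+ n _ _ ⟩
    degSumA + degSumB G side                                          ≡⟨ cong (_+ degSumB G side) degSumA≡degSumB ⟩
    degSumB G side + degSumB G side                                   ≡⟨ cong (degSumB G side +_) (sym (+-identityʳ _)) ⟩
    2 * degSumB G side                                                ∎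
    where
    open ≡-Reasoning
    degSumA : ℕ
    degSumA = sumFin n (λ v → 𝟙 (side v) * deg G v)
    degSumA≡degSumB : degSumA ≡ degSumB G side
    degSumA≡degSumB = begin
      sumFin n (λ v → 𝟙 (side v) * deg G v)
        ≡⟨ sumFin-cong n (λ v → sym (sumFin-*ˡ n (𝟙 (side v)) _)) ⟩
      sumFin n (λ v → sumFin n (λ w → 𝟙 (side v) * 𝟙 (adj G v w)))
        ≡⟨ sumFin-swap n n _ ⟩
      sumFin n (λ w → sumFin n (λ v → 𝟙 (side v) * 𝟙 (adj G v w)))
        ≡⟨ sumFin-cong n (λ w → sumFin-cong n (λ v → 𝟙-A-end≡𝟙-B-end v w)) ⟩
      sumFin n (λ w → sumFin n (λ v → 𝟙 (not (side w)) * 𝟙 (adj G w v)))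
        ≡⟨ sumFin-cong n (λ w → sumFin-*ˡ n (𝟙 (not (side w))) _) ⟩
      degSumB G side ∎

induced : ∀ {n} → Graph n → (Fin n → Bool) → Graph n
induced G U = record
  { adj    = λ u v → adj G u v ∧ (U u ∧ U v)
  ; sym    = λ u v → cong₂ _∧_ (Graph.sym G u v) (∧-comm (U u) (U v))
  ; irrefl = λ v → cong (_∧ (U v ∧ U v)) (Graph.irrefl G v)
  }

module _ {n} (G : Graph n) (U : Fin n → Bool) where

  IsSubgraph-induced : ∀ {S} → (∀ v → U v ≡ true → S v ≡ true) → IsSubgraph G S (induced G U)
  IsSubgraph-induced U⊆S u v uv =
    let Uu∧Uv = ∧-conicalʳ (adj G u v) _ uv
    in ∧-conicalˡ _ _ uv , U⊆S u (∧-conicalˡ _ _ Uu∧Uv) , U⊆S v (∧-conicalʳ _ _ Uu∧Uv)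

  IsBipartition-induced : ∀ {side} → IsBipartition G side → IsBipartition (induced G U) side
  IsBipartition-induced bip u v uv = bip u v (∧-conicalˡ _ _ uv)

  deg-induced-≤ : ∀ v → deg (induced G U) v ≤ deg G v
  deg-induced-≤ v = sumFin-mono n (λ x → 𝟙-∧-≤ˡ (adj G v x) _)

  deg-induced : ∀ v → deg (induced G U) v ≡ (if U v then sumFin n (λ x → 𝟙 (adj G v x ∧ U x)) else 0)
  deg-induced v with U v
  ... | true  = refl
  ... | false = trans (sumFin-cong n (λ x → cong 𝟙 (∧-zeroʳ (adj G v x)))) (sumFin-zero n)

cap : ℕ → ℕ → ℕ
cap k e = if e ≤ᵇ k then e else 0

-- Either e ≤ k, or the lost mass k * e is absorbed by e * e ≥ k * e.
k*e≤k*cap+e*e : ∀ k e → k * e ≤ k * cap k e + e * e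
k*e≤k*cap+e*e k e with e ≤ᵇ k in e≤k
... | true  = m≤m+n (k * e) (e * e)
... | false = ≤-trans (*-monoˡ-≤ e k≤e) (m≤n+m (e * e) (k * 0))
  where
  k≤e : k ≤ e
  k≤e = <⇒≤ (≰⇒> (λ e≤k′ → subst T e≤k (≤⇒≤ᵇ e≤k′)))

three-eighths : ∀ k P K Q → 8 ≤ k → k * P ≤ k * K + Q → 2 * Q ≤ 2 * P + k * P → 3 * P ≤ 8 * K
three-eighths k P K Q 8≤k kP≤kK+Q 2Q≤2P+kP =
  *-cancelˡ-≤ k {{>-nonZero (≤-trans (s≤s z≤n) 8≤k)}} (+-cancelʳ-≤ (8 * P) _ _ (begin
    k * (3 * P) + 8 * P  ≤⟨ +-monoʳ-≤ (k * (3 * P)) (*-monoˡ-≤ P 8≤k) ⟩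
    k * (3 * P) + k * P  ≡⟨ four k P ⟩
    4 * (k * P)          ≤⟨ *-monoʳ-≤ 4 kP≤2kK+2P ⟩
    4 * (2 * k * K + 2 * P) ≡⟨ expand k K P ⟩
    k * (8 * K) + 8 * P  ∎))
  where
  open ≤-Reasoning
  four : ∀ k P → k * (3 * P) + k * P ≡ 4 * (k * P)
  four = solve-∀
  expand : ∀ k K P → 4 * (2 * k * K + 2 * P) ≡ k * (8 * K) + 8 * P
  expand = solve-∀
  kP≤2kK+2P : k * P ≤ 2 * k * K + 2 * P
  kP≤2kK+2P = +-cancelʳ-≤ (k * P) _ _ (begin
    k * P + k * P              ≡⟨ double (k * P) ⟩
    2 * (k * P)                ≤⟨ *-monoʳ-≤ 2 kP≤kK+Q ⟩
    2 * (k * K + Q)            ≡⟨ *-distribˡ-+ 2 (k * K) Q ⟩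
    2 * (k * K) + 2 * Q        ≤⟨ +-monoʳ-≤ (2 * (k * K)) 2Q≤2P+kP ⟩
    2 * (k * K) + (2 * P + k * P) ≡⟨ regroup k K P ⟩
    2 * k * K + 2 * P + k * P  ∎)
    where
    double : ∀ x → x + x ≡ 2 * x
    double = solve-∀
    regroup : ∀ k K P → 2 * (k * K) + (2 * P + k * P) ≡ 2 * k * K + 2 * P + k * P
    regroup = solve-∀

colourDeg : ∀ {n m} → Graph n → (Fin n → Fin m) → Fin m → Fin n → ℕ
colourDeg {n} G f j v = sumFin n (λ x → 𝟙 (adj G v x ∧ (f x == j)))

module ColourDegrees {n} (G : Graph n) (v : Fin n) (m : ℕ) where

  private
    a : Fin n → ℕ
    a x = 𝟙 (adj G v x)

    d : ℕ
    d = deg G v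

  sumFin-colourDeg : ∀ f → sumFin m (λ j → colourDeg G f j v) ≡ d
  sumFin-colourDeg f = trans (sumFin-swap m n _) (sumFin-cong n (λ x → sumFin-𝟙-∧-== m (adj G v x) (f x)))

  sumFin-colourDeg² : ∀ f → sumFin m (λ j → colourDeg G f j v * colourDeg G f j v)
                          ≡ sumFin n (λ x → sumFin n (λ y → a x * a y * 𝟙 (f x == f y)))
  sumFin-colourDeg² f =
    trans (sumFin-cong m (λ j → sumFin-*-sumFin n n _ _))
      (trans (sumFin-swap m n _)
        (sumFin-cong n (λ x → trans (sumFin-swap m n _) (sumFin-cong n (λ y → same-colour x y)))))
    where
    open ≡-Reasoning
    reorder : ∀ p q r s → p * r * (q * s) ≡ p * q * (r * s)
    reorder = solve-∀
    same-colour : ∀ x y → sumFin m (λ j → 𝟙 (adj G v x ∧ (f x == j)) * 𝟙 (adj G v y ∧ (f y == j)))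
                            ≡ a x * a y * 𝟙 (f x == f y)
    same-colour x y = begin
      sumFin m (λ j → 𝟙 (adj G v x ∧ (f x == j)) * 𝟙 (adj G v y ∧ (f y == j)))
        ≡⟨ sumFin-cong m (λ j → trans (cong₂ _*_ (𝟙-∧ (adj G v x) _) (𝟙-∧ (adj G v y) _)) (reorder (a x) (a y) _ _)) ⟩
      sumFin m (λ j → a x * a y * (𝟙 (f x == j) * 𝟙 (f y == j)))
        ≡⟨ sumFin-*ˡ m (a x * a y) _ ⟩
      a x * a y * sumFin m (λ j → 𝟙 (f x == j) * 𝟙 (f y == j))
        ≡⟨ cong (a x * a y *_) (trans (sumFin-δ m (f x) _) (cong 𝟙 (==-sym (f y) (f x)))) ⟩
      a x * a y * 𝟙 (f x == f y) ∎

  colourDeg-second-moment :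
    m * sumMaps n m (λ f → sumFin m (λ j → colourDeg G f j v * colourDeg G f j v)) ≤ m ^ n * (m * d + d * d)
  colourDeg-second-moment = begin
    m * sumMaps n m (λ f → sumFin m (λ j → colourDeg G f j v * colourDeg G f j v))
      ≡⟨ cong (m *_) (sumMaps-cong n m sumFin-colourDeg²) ⟩
    m * sumMaps n m (λ f → sumFin n (λ x → sumFin n (λ y → a x * a y * 𝟙 (f x == f y))))
      ≡⟨ cong (m *_) (trans (sumMaps-sumFin n m n _) (sumFin-cong n (λ x → sumMaps-sumFin n m n _))) ⟩
    m * sumFin n (λ x → sumFin n (λ y → sumMaps n m (λ f → a x * a y * 𝟙 (f x == f y))))
      ≡⟨ trans (sym (sumFin-*ˡ n m _)) (sumFin-cong n (λ x → sym (sumFin-*ˡ n m _))) ⟩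
    sumFin n (λ x → sumFin n (λ y → m * sumMaps n m (λ f → a x * a y * 𝟙 (f x == f y))))
      ≡⟨ sumFin-cong n (λ x → sumFin-cong n (λ y → pull (a x * a y) _)) ⟩
    sumFin n (λ x → sumFin n (λ y → a x * a y * (m * sumMaps n m (λ f → 𝟙 (f x == f y)))))
      ≤⟨ sumFin-mono n (λ x → sumFin-mono n (λ y → *-monoʳ-≤ (a x * a y) (sumMaps-collision n m x y))) ⟩
    sumFin n (λ x → sumFin n (λ y → a x * a y * (m ^ n * (m * 𝟙 (x == y) + 1))))
      ≡⟨ sumFin-cong n (λ x → trans (sumFin-cong n (λ y → expand (a x * a y) (m ^ n) m _)) (sumFin-+ n _ _)) ⟩
    sumFin n (λ x → sumFin n (λ y → m ^ n * m * (𝟙 (x == y) * (a x * a y))) + sumFin n (λ y → m ^ n * (a x * a y)))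
      ≡⟨ sumFin-+ n _ _ ⟩
    sumFin n (λ x → sumFin n (λ y → m ^ n * m * (𝟙 (x == y) * (a x * a y)))) + sumFin n (λ x → sumFin n (λ y → m ^ n * (a x * a y)))
      ≡⟨ cong₂ _+_ diagonal all-pairs ⟩
    m ^ n * m * d + m ^ n * (d * d)
      ≡⟨ collect (m ^ n) m d ⟩
    m ^ n * (m * d + d * d) ∎
    where
    open ≤-Reasoning
    pull : ∀ c s → m * sumMaps n m (λ f → c * s f) ≡ c * (m * sumMaps n m s)
    pull c s = trans (cong (m *_) (sumMaps-*ˡ n m c s)) (x*[y*z]≡y*[x*z] m c _)
      where
      x*[y*z]≡y*[x*z] : ∀ x y z → x * (y * z) ≡ y * (x * z)
      x*[y*z]≡y*[x*z] = solve-∀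
    expand : ∀ c M m e → c * (M * (m * e + 1)) ≡ M * m * (e * c) + M * c
    expand = solve-∀
    collect : ∀ M m d → M * m * d + M * (d * d) ≡ M * (m * d + d * d)
    collect = solve-∀
    diagonal : sumFin n (λ x → sumFin n (λ y → m ^ n * m * (𝟙 (x == y) * (a x * a y)))) ≡ m ^ n * m * d
    diagonal = begin-equality
      sumFin n (λ x → sumFin n (λ y → m ^ n * m * (𝟙 (x == y) * (a x * a y))))
        ≡⟨ sumFin-cong n (λ x → sumFin-*ˡ n (m ^ n * m) _) ⟩
      sumFin n (λ x → m ^ n * m * sumFin n (λ y → 𝟙 (x == y) * (a x * a y)))
        ≡⟨ sumFin-*ˡ n (m ^ n * m) _ ⟩
      m ^ n * m * sumFin n (λ x → sumFin n (λ y → 𝟙 (x == y) * (a x * a y)))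
        ≡⟨ cong (m ^ n * m *_) (sumFin-cong n (λ x → trans (sumFin-δ n x (λ y → a x * a y)) (𝟙-idem (adj G v x)))) ⟩
      m ^ n * m * d ∎
    all-pairs : sumFin n (λ x → sumFin n (λ y → m ^ n * (a x * a y))) ≡ m ^ n * (d * d)
    all-pairs = begin-equality
      sumFin n (λ x → sumFin n (λ y → m ^ n * (a x * a y))) ≡⟨ sumFin-cong n (λ x → sumFin-*ˡ n (m ^ n) _) ⟩
      sumFin n (λ x → m ^ n * sumFin n (λ y → a x * a y))   ≡⟨ sumFin-*ˡ n (m ^ n) _ ⟩
      m ^ n * sumFin n (λ x → sumFin n (λ y → a x * a y))   ≡⟨ cong (m ^ n *_) (sym (sumFin-*-sumFin n n a a)) ⟩
      m ^ n * (d * d)                                       ∎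

  capped-mass : ∀ k → 8 ≤ k → 2 * d ≤ k * m → .{{_ : NonZero m}} →
    3 * (m ^ n * d) ≤ 8 * sumMaps n m (λ f → sumFin m (λ j → cap k (colourDeg G f j v)))
  capped-mass k 8≤k 2d≤km = three-eighths k (m ^ n * d) K Q 8≤k kP≤kK+Q 2Q≤2P+kP
    where
    open ≤-Reasoning
    K Q : ℕ
    K = sumMaps n m (λ f → sumFin m (λ j → cap k (colourDeg G f j v)))
    Q = sumMaps n m (λ f → sumFin m (λ j → colourDeg G f j v * colourDeg G f j v))
    kP≤kK+Q : k * (m ^ n * d) ≤ k * K + Q
    kP≤kK+Q = begin
      k * (m ^ n * d)
        ≡⟨ cong (k *_) (sym (trans (sumMaps-cong n m sumFin-colourDeg) (sumMaps-const n m d))) ⟩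
      k * sumMaps n m (λ f → sumFin m (λ j → colourDeg G f j v))
        ≡⟨ trans (sym (sumMaps-*ˡ n m k _)) (sumMaps-cong n m (λ f → sym (sumFin-*ˡ m k _))) ⟩
      sumMaps n m (λ f → sumFin m (λ j → k * colourDeg G f j v))
        ≤⟨ sumMaps-mono n m (λ f → sumFin-mono m (λ j → k*e≤k*cap+e*e k (colourDeg G f j v))) ⟩
      sumMaps n m (λ f → sumFin m (λ j → k * cap k (colourDeg G f j v) + colourDeg G f j v * colourDeg G f j v))
        ≡⟨ trans (sumMaps-cong n m (λ f → trans (sumFin-+ m _ _) (cong (_+ _) (sumFin-*ˡ m k _)))) (sumMaps-+ n m _ _) ⟩
      sumMaps n m (λ f → k * sumFin m (λ j → cap k (colourDeg G f j v))) + Q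
        ≡⟨ cong (_+ Q) (sumMaps-*ˡ n m k _) ⟩
      k * K + Q ∎
    2Q≤2P+kP : 2 * Q ≤ 2 * (m ^ n * d) + k * (m ^ n * d)
    2Q≤2P+kP = *-cancelˡ-≤ m (begin
      m * (2 * Q)                              ≡⟨ x*[y*z]≡y*[x*z] m 2 Q ⟩
      2 * (m * Q)                              ≤⟨ *-monoʳ-≤ 2 colourDeg-second-moment ⟩
      2 * (m ^ n * (m * d + d * d))            ≡⟨ expand (m ^ n) m d ⟩
      m * (2 * (m ^ n * d)) + m ^ n * (2 * d * d) ≤⟨ +-monoʳ-≤ (m * (2 * (m ^ n * d))) (*-monoʳ-≤ (m ^ n) (*-monoˡ-≤ d 2d≤km)) ⟩
      m * (2 * (m ^ n * d)) + m ^ n * (k * m * d) ≡⟨ collect (m ^ n) m d k ⟩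
      m * (2 * (m ^ n * d) + k * (m ^ n * d))  ∎)
      where
      x*[y*z]≡y*[x*z] : ∀ x y z → x * (y * z) ≡ y * (x * z)
      x*[y*z]≡y*[x*z] = solve-∀
      expand : ∀ M m d → 2 * (M * (m * d + d * d)) ≡ m * (2 * (M * d)) + M * (2 * d * d)
      expand = solve-∀
      collect : ∀ M m d k → m * (2 * (M * d)) + M * (k * m * d) ≡ m * (2 * (M * d) + k * (M * d))
      collect = solve-∀

m<n*o⇒0<o : ∀ m n o → m < n * o → 0 < o
m<n*o⇒0<o m n zero    m<n*0 = ⊥-elim (n≮0 (subst (m <_) (*-zeroʳ n) m<n*0))
m<n*o⇒0<o m n (suc o) _     = s≤s z≤n

sumFin-positive : ∀ n (f : Fin n → ℕ) → 0 < sumFin n f → Σ (Fin n) λ i → 0 < f i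
sumFin-positive n f 0<Σf = sumFin-<⇒∃< n (λ _ → 0) f (subst (_< sumFin n f) (sym (sumFin-zero n)) 0<Σf)

card-positive : ∀ {n} (G H : Graph n) S → IsSubgraph G S H → 0 < degSum H → 0 < card S
card-positive {n} G H S H⊆S 0<degSum =
  let (v , 0<deg) = sumFin-positive n (deg H) 0<degSum
      (w , 0<𝟙)   = sumFin-positive n (λ w → 𝟙 (adj H v w)) 0<deg
      Sv          = proj₁ (proj₂ (H⊆S v w (𝟙-positive 0<𝟙)))
  in ≤-trans (≤-reflexive (cong 𝟙 (sym Sv))) (term≤sumFin n (λ u → 𝟙 (S u)) v)

LnGe-intro : ∀ k M D a → 2 ^ (4 * M) ≤ k ^ 400 → a < M * D → LnGe k a (400 * D)
LnGe-intro k M D a 2^4M≤k^400 a<MD =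
  ≤-trans (m<n*o⇒0<o a M D a<MD) (m≤n*m D 400) ,
  λ N → ≤-trans (expPartial-≤ a N) (*-monoˡ-≤ (N !) 2*16^a≤k^[400D])
  where
  open ≤-Reasoning
  3+[1+4a]≡4[1+a] : ∀ a → 3 + suc (4 * a) ≡ 4 * suc a
  3+[1+4a]≡4[1+a] = solve-∀
  1+4a≤4MD : suc (4 * a) ≤ 4 * M * D
  1+4a≤4MD = begin
    suc (4 * a)      ≤⟨ m≤n+m (suc (4 * a)) 3 ⟩
    3 + suc (4 * a)  ≡⟨ 3+[1+4a]≡4[1+a] a ⟩
    4 * suc a        ≤⟨ *-monoʳ-≤ 4 a<MD ⟩
    4 * (M * D)      ≡⟨ sym (*-assoc 4 M D) ⟩
    4 * M * D        ∎
  2*16^a≤k^[400D] : 2 * 16 ^ a ≤ k ^ (400 * D)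
  2*16^a≤k^[400D] = begin
    2 * 16 ^ a          ≡⟨ cong (2 *_) (^-*-assoc 2 4 a) ⟩
    2 ^ suc (4 * a)     ≤⟨ ^-monoʳ-≤ 2 1+4a≤4MD ⟩
    2 ^ (4 * M * D)     ≡⟨ sym (^-*-assoc 2 (4 * M) D) ⟩
    (2 ^ (4 * M)) ^ D   ≤⟨ ^-monoˡ-≤ D 2^4M≤k^400 ⟩
    (k ^ 400) ^ D       ≡⟨ ^-*-assoc k 400 D ⟩
    k ^ (400 * D)       ∎

module Construction (k : ℕ) {n} (G : Graph n) (side : Fin n → Bool) (bip : IsBipartition G side)
                    (A-deg≤k : ∀ v → side v ≡ true → deg G v ≤ k) where

  inClass : ℕ → ℕ → Bool
  inClass zero    d = d ≤ᵇ k
  inClass (suc t) d = (d ≤ᵇ k * 2 ^ suc t) ∧ (k * 2 ^ t <ᵇ d)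

  inClass⇒≤ : ∀ t d → inClass t d ≡ true → d ≤ k * 2 ^ t
  inClass⇒≤ zero    d d≤k = ≤-trans (≤ᵇ⇒≤ d k (from T-≡ d≤k)) (≤-reflexive (sym (*-identityʳ k)))
  inClass⇒≤ (suc t) d cls = ≤ᵇ⇒≤ d _ (from T-≡ (∧-conicalˡ _ _ cls))

  classB : ℕ → Fin n → Bool
  classB t v = not (side v) ∧ inClass t (deg G v)

  classB⇒B : ∀ t v → classB t v ≡ true → side v ≡ false
  classB⇒B t v cls with side v
  classB⇒B t v cls | false = refl
  classB⇒B t v ()  | true

  sizeA sizeB : ℕ
  sizeA = sumFin n (λ v → 𝟙 (side v))
  sizeB = sumFin n (λ v → 𝟙 (not (side v)))

  classSize classDegSum : ℕ → ℕ
  classSize   t = sumFin n (λ v → 𝟙 (classB t v))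
  classDegSum t = sumFin n (λ v → 𝟙 (classB t v) * deg G v)

  module Colouring (t : ℕ) {m} (f : Fin n → Fin m) (j : Fin m) where

    S : Fin n → Bool
    S v = if side v then f v == j else inClass t (deg G v)

    kept : Fin n → Bool
    kept v = S v ∧ (side v ∨ (colourDeg G f j v ≤ᵇ k))

    H : Graph n
    H = induced G kept

    H⊆S : IsSubgraph G S H
    H⊆S = IsSubgraph-induced G kept (λ v → ∧-conicalˡ (S v) _)

    H-bip : IsBipartition H side
    H-bip = IsBipartition-induced G kept bip

    kept-A : ∀ x → side x ≡ true → kept x ≡ (f x == j)
    kept-A x sx rewrite sx = ∧-identityʳ (f x == j)

    deg-H-B : ∀ v → side v ≡ false → deg H v ≡ (if kept v then colourDeg G f j v else 0)
    deg-H-B v sv = trans (deg-induced G kept v) (cong (if kept v then_else 0) (sumFin-cong n adj∧kept))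
      where
      adj∧kept : ∀ x → 𝟙 (adj G v x ∧ kept x) ≡ 𝟙 (adj G v x ∧ (f x == j))
      adj∧kept x with adj G v x in vx
      ... | false = refl
      ... | true  = cong 𝟙 (kept-A x (nbr-of-B-in-A G side bip sv vx))

    deg-H-≤ : ∀ v → deg H v ≤ k
    deg-H-≤ v = by-side (side v) refl
      where
      B-case : side v ≡ false → deg H v ≤ k
      B-case sv rewrite deg-H-B v sv with kept v in kv
      ... | true  = ≤ᵇ⇒≤ _ k (from T-≡ (subst (λ s → s ∨ _ ≡ true) sv (∧-conicalʳ _ _ kv)))
      ... | false = z≤n
      by-side : ∀ b → side v ≡ b → deg H v ≤ k
      by-side true  sv = ≤-trans (deg-induced-≤ G kept v) (A-deg≤k v sv)
      by-side false sv = B-case sv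

    deg-H-class : ∀ v → classB t v ≡ true → deg H v ≡ cap k (colourDeg G f j v)
    deg-H-class v cls
      rewrite deg-H-B v (classB⇒B t v cls) | classB⇒B t v cls | ∧-conicalʳ (not (side v)) _ cls = refl

    card-S : card S ≡ sumFin n (λ v → 𝟙 (side v ∧ (f v == j))) + classSize t
    card-S = trans (sumFin-cong n (λ v → 𝟙-if (side v) _ _)) (sumFin-+ n _ _)

  module ClassAverages (t : ℕ) where

    m : ℕ
    m = 2 ^ suc t

    instance
      m≢0 : NonZero m
      m≢0 = m^n≢0 2 (suc t)

    open Colouring t {m}

    average-card : sumMaps n m (λ f → sumFin m (λ j → card (S f j))) ≡ m ^ n * (sizeA + m * classSize t)
    average-card = trans (sumMaps-cong n m per-colouring) (sumMaps-const n m _)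
      where
      open ≡-Reasoning
      per-colouring : ∀ f → sumFin m (λ j → card (S f j)) ≡ sizeA + m * classSize t
      per-colouring f = begin
        sumFin m (λ j → card (S f j))
          ≡⟨ sumFin-cong m (λ j → card-S f j) ⟩
        sumFin m (λ j → sumFin n (λ v → 𝟙 (side v ∧ (f v == j))) + classSize t)
          ≡⟨ sumFin-+ m _ _ ⟩
        sumFin m (λ j → sumFin n (λ v → 𝟙 (side v ∧ (f v == j)))) + sumFin m (λ _ → classSize t)
          ≡⟨ cong₂ _+_ (trans (sumFin-swap m n _) (sumFin-cong n (λ v → sumFin-𝟙-∧-== m (side v) (f v))))
                       (sumFin-const m _) ⟩
        sizeA + m * classSize t ∎

    average-degSum : 8 ≤ k → 3 * (m ^ n * classDegSum t) ≤ 4 * sumMaps n m (λ f → sumFin m (λ j → degSum (H f j)))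
    average-degSum 8≤k = begin
      3 * (m ^ n * classDegSum t)
        ≡⟨ trans (cong (3 *_) (sym (sumFin-*ˡ n (m ^ n) _))) (sym (sumFin-*ˡ n 3 _)) ⟩
      sumFin n (λ v → 3 * (m ^ n * (𝟙 (classB t v) * deg G v)))
        ≡⟨ sumFin-cong n (λ v → reorder (𝟙 (classB t v)) (m ^ n) (deg G v)) ⟩
      sumFin n (λ v → 𝟙 (classB t v) * (3 * (m ^ n * deg G v)))
        ≤⟨ sumFin-mono n (λ v → 𝟙*-mono (classB t v) (λ cls →
             ColourDegrees.capped-mass G v m k 8≤k (2*deg≤k*m v cls))) ⟩
      sumFin n (λ v → 𝟙 (classB t v) * (8 * sumMaps n m (λ f → sumFin m (λ j → cap k (colourDeg G f j v)))))
        ≡⟨ trans (sumFin-cong n (λ v → push-in (classB t v) _)) (sumFin-*ˡ n 8 _) ⟩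
      8 * sumFin n (λ v → sumMaps n m (λ f → sumFin m (λ j → 𝟙 (classB t v) * cap k (colourDeg G f j v))))
        ≡⟨ cong (8 *_) (trans (sym (sumMaps-sumFin n m n _)) (sumMaps-cong n m (λ f → sumFin-swap n m _))) ⟩
      8 * sumMaps n m (λ f → sumFin m (λ j → sumFin n (λ v → 𝟙 (classB t v) * cap k (colourDeg G f j v))))
        ≡⟨ cong (8 *_) (sumMaps-cong n m (λ f → sumFin-cong m (λ j → sumFin-cong n (λ v →
             𝟙*-cong (classB t v) (λ cls → sym (deg-H-class f j v cls)))))) ⟩
      8 * sumMaps n m (λ f → sumFin m (λ j → sumFin n (λ v → 𝟙 (classB t v) * deg (H f j) v)))
        ≤⟨ *-monoʳ-≤ 8 (sumMaps-mono n m (λ f → sumFin-mono m (λ j → sumFin-mono n (λ v →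
             *-monoˡ-≤ (deg (H f j) v) (𝟙-∧-≤ˡ (not (side v)) _))))) ⟩
      8 * sumMaps n m (λ f → sumFin m (λ j → degSumB (H f j) side))
        ≡⟨ trans (*-assoc 4 2 (sumMaps n m (λ f → sumFin m (λ j → degSumB (H f j) side))))
             (cong (4 *_) (trans (sym (sumMaps-*ˡ n m 2 _))
               (sumMaps-cong n m (λ f → sym (sumFin-*ˡ m 2 (λ j → degSumB (H f j) side)))))) ⟩
      4 * sumMaps n m (λ f → sumFin m (λ j → 2 * degSumB (H f j) side))
        ≡⟨ cong (4 *_) (sumMaps-cong n m (λ f → sumFin-cong m (λ j →
             sym (degSum≡2*degSumB (H f j) side (H-bip f j))))) ⟩
      4 * sumMaps n m (λ f → sumFin m (λ j → degSum (H f j))) ∎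
      where
      open ≤-Reasoning
      reorder : ∀ b M d → 3 * (M * (b * d)) ≡ b * (3 * (M * d))
      reorder = solve-∀
      2*deg≤k*m : ∀ v → classB t v ≡ true → 2 * deg G v ≤ k * m
      2*deg≤k*m v cls = ≤-trans (*-monoʳ-≤ 2 (inClass⇒≤ t (deg G v) (∧-conicalʳ _ _ cls)))
                                (≤-reflexive (x*[y*z]≡y*[x*z] 2 k (2 ^ t)))
        where
        x*[y*z]≡y*[x*z] : ∀ x y z → x * (y * z) ≡ y * (x * z)
        x*[y*z]≡y*[x*z] = solve-∀
      push-in : ∀ b (F : (Fin n → Fin m) → Fin m → ℕ) →
        𝟙 b * (8 * sumMaps n m (λ f → sumFin m (F f))) ≡ 8 * sumMaps n m (λ f → sumFin m (λ j → 𝟙 b * F f j))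
      push-in b F = begin-equality
        𝟙 b * (8 * sumMaps n m (λ f → sumFin m (F f)))  ≡⟨ x*[y*z]≡y*[x*z] (𝟙 b) 8 _ ⟩
        8 * (𝟙 b * sumMaps n m (λ f → sumFin m (F f)))  ≡⟨ cong (8 *_) (sym (sumMaps-*ˡ n m (𝟙 b) _)) ⟩
        8 * sumMaps n m (λ f → 𝟙 b * sumFin m (F f))    ≡⟨ cong (8 *_) (sumMaps-cong n m (λ f → sym (sumFin-*ˡ m (𝟙 b) _))) ⟩
        8 * sumMaps n m (λ f → sumFin m (λ j → 𝟙 b * F f j)) ∎
        where
        x*[y*z]≡y*[x*z] : ∀ x y z → x * (y * z) ≡ y * (x * z)
        x*[y*z]≡y*[x*z] = solve-∀

    dense-on-average : 8 ≤ k → ∀ M → 4 * (k * (sizeA + m * classSize t)) < 3 * M * classDegSum t →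
      sumMaps n m (λ f → sumFin m (λ j → k * card (S f j))) < sumMaps n m (λ f → sumFin m (λ j → M * degSum (H f j)))
    dense-on-average 8≤k M dense-class = *-cancelˡ-< 4 _ _ (begin-strict
      4 * sumMaps n m (λ f → sumFin m (λ j → k * card (S f j)))
        ≡⟨ cong (4 *_) (pull-out k (λ f j → card (S f j))) ⟩
      4 * (k * sumMaps n m (λ f → sumFin m (λ j → card (S f j))))
        ≡⟨ cong (λ x → 4 * (k * x)) average-card ⟩
      4 * (k * (m ^ n * (sizeA + m * classSize t)))
        ≡⟨ reorder₁ k (m ^ n) _ ⟩
      m ^ n * (4 * (k * (sizeA + m * classSize t)))
        <⟨ *-monoʳ-< (m ^ n) {{m^n≢0 m n}} dense-class ⟩
      m ^ n * (3 * M * classDegSum t)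
        ≡⟨ reorder₂ (m ^ n) M (classDegSum t) ⟩
      M * (3 * (m ^ n * classDegSum t))
        ≤⟨ *-monoʳ-≤ M (average-degSum 8≤k) ⟩
      M * (4 * sumMaps n m (λ f → sumFin m (λ j → degSum (H f j))))
        ≡⟨ x*[y*z]≡y*[x*z] M 4 _ ⟩
      4 * (M * sumMaps n m (λ f → sumFin m (λ j → degSum (H f j))))
        ≡⟨ cong (4 *_) (sym (pull-out M (λ f j → degSum (H f j)))) ⟩
      4 * sumMaps n m (λ f → sumFin m (λ j → M * degSum (H f j))) ∎)
      where
      open ≤-Reasoning
      pull-out : ∀ c (F : (Fin n → Fin m) → Fin m → ℕ) →
        sumMaps n m (λ f → sumFin m (λ j → c * F f j)) ≡ c * sumMaps n m (λ f → sumFin m (F f))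
      pull-out c F = trans (sumMaps-cong n m (λ f → sumFin-*ˡ m c (F f))) (sumMaps-*ˡ n m c _)
      reorder₁ : ∀ k P X → 4 * (k * (P * X)) ≡ P * (4 * (k * X))
      reorder₁ = solve-∀
      reorder₂ : ∀ P M E → P * (3 * M * E) ≡ M * (3 * (P * E))
      reorder₂ = solve-∀
      x*[y*z]≡y*[x*z] : ∀ x y z → x * (y * z) ≡ y * (x * z)
      x*[y*z]≡y*[x*z] = solve-∀

  cost : ℕ → ℕ → ℕ
  cost d t = k * 2 ^ suc t * 𝟙 (inClass t d)

  cost-≤ : ∀ d t → cost d t ≤ k * 2 ^ suc t
  cost-≤ d t = ≤-trans (*-monoʳ-≤ (k * 2 ^ suc t) (𝟙≤1 _)) (≤-reflexive (*-identityʳ _))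

  sumTo-cost-geometric : ∀ d T → sumTo T (λ t → cost d (suc t)) ≤ 4 * (k * 2 ^ T)
  sumTo-cost-geometric d T = begin
    sumTo T (λ t → cost d (suc t))       ≤⟨ sumFin-mono T (λ i → cost-≤ d (suc (toℕ i))) ⟩
    sumTo T (λ t → k * 2 ^ suc (suc t))  ≡⟨ sumFin-cong T (λ i → reorder k (2 ^ toℕ i)) ⟩
    sumTo T (λ t → 4 * k * 2 ^ t)        ≡⟨ sumFin-*ˡ T (4 * k) _ ⟩
    4 * k * sumTo T (2 ^_)               ≤⟨ *-monoʳ-≤ (4 * k) (<⇒≤ (sumTo-2^ T)) ⟩
    4 * k * 2 ^ T                        ≡⟨ *-assoc 4 k (2 ^ T) ⟩
    4 * (k * 2 ^ T)                      ∎
    where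
    open ≤-Reasoning
    reorder : ∀ k x → k * (2 * (2 * x)) ≡ 4 * k * x
    reorder = solve-∀

  -- Only the class containing d contributes, and for t ≥ 1 its cost k 2^(t+1) is below 4 d.
  sumTo-cost-≤ : ∀ d T → sumTo T (λ t → cost d (suc t)) ≤ 8 * d
  sumTo-cost-≤ d zero    = z≤n
  sumTo-cost-≤ d (suc T) = begin
    sumTo (suc T) (λ t → cost d (suc t))             ≡⟨ sumTo-suc T (λ t → cost d (suc t)) ⟩
    sumTo T (λ t → cost d (suc t)) + cost d (suc T)  ≤⟨ by-class (inClass (suc T) d) refl ⟩
    8 * d                                            ∎
    where
    open ≤-Reasoning
    reorder : ∀ k x → 4 * (k * x) + k * (2 * (2 * x)) ≡ 8 * (k * x)
    reorder = solve-∀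
    earlier : ℕ
    earlier = sumTo T (λ t → cost d (suc t))
    by-class : ∀ b → inClass (suc T) d ≡ b → earlier + cost d (suc T) ≤ 8 * d
    by-class false cls = begin
      earlier + cost d (suc T)               ≡⟨ cong (λ c → earlier + k * 2 ^ suc (suc T) * 𝟙 c) cls ⟩
      earlier + k * 2 ^ suc (suc T) * 0      ≡⟨ cong (earlier +_) (*-zeroʳ (k * 2 ^ suc (suc T))) ⟩
      earlier + 0                            ≡⟨ +-identityʳ earlier ⟩
      earlier                                ≤⟨ sumTo-cost-≤ d T ⟩
      8 * d                            ∎
    by-class true cls = begin
      earlier + cost d (suc T)                     ≤⟨ +-mono-≤ (sumTo-cost-geometric d T) (cost-≤ d (suc T)) ⟩
      4 * (k * 2 ^ T) + k * 2 ^ suc (suc T)  ≡⟨ reorder k (2 ^ T) ⟩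
      8 * (k * 2 ^ T)                        ≤⟨ *-monoʳ-≤ 8 (<⇒≤ (<ᵇ⇒< _ d (from T-≡ (∧-conicalʳ _ _ cls)))) ⟩
      8 * d                                  ∎

  sumTo-cost : ∀ d T → sumTo (suc T) (cost d) ≤ 2 * k + 8 * d
  sumTo-cost d T = +-mono-≤ (≤-trans (cost-≤ d 0) (≤-reflexive (*-comm k 2))) (sumTo-cost-≤ d T)

  inSomeClass : ∀ d T → d ≤ k * 2 ^ T → 1 ≤ sumTo (suc T) (λ t → 𝟙 (inClass t d))
  inSomeClass d zero d≤k rewrite to T-≡ (≤⇒≤ᵇ (≤-trans d≤k (≤-reflexive (*-identityʳ k)))) = ≤-refl
  inSomeClass d (suc T) d≤k2^T+1 rewrite sumTo-suc (suc T) (λ t → 𝟙 (inClass t d)) with d ≤? k * 2 ^ T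
  ... | yes d≤k2^T = ≤-trans (inSomeClass d T d≤k2^T) (m≤m+n _ _)
  ... | no  d≰k2^T = ≤-trans (≤-reflexive (cong 𝟙 (sym in-last))) (m≤n+m _ _)
    where
    in-last : inClass (suc T) d ≡ true
    in-last rewrite to T-≡ (≤⇒≤ᵇ d≤k2^T+1) | to T-≡ (<⇒<ᵇ (≰⇒> d≰k2^T)) = refl

  sizeA+sizeB≡n : sizeA + sizeB ≡ n
  sizeA+sizeB≡n = begin
    sizeA + sizeB                              ≡⟨ sym (sumFin-+ n (λ v → 𝟙 (side v)) (λ v → 𝟙 (not (side v)))) ⟩
    sumFin n (λ v → 𝟙 (side v) + 𝟙 (not (side v))) ≡⟨ sumFin-cong n (λ v → 𝟙+𝟙-not (side v)) ⟩
    sumFin n (λ _ → 1)                         ≡⟨ sumFin-const n 1 ⟩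
    n * 1                                      ≡⟨ *-identityʳ n ⟩
    n                                          ∎
    where open ≡-Reasoning

  classCost≡ : ∀ t → k * (2 ^ suc t * classSize t) ≡ sumFin n (λ v → 𝟙 (not (side v)) * cost (deg G v) t)
  classCost≡ t = begin
    k * (2 ^ suc t * classSize t)                   ≡⟨ cong (k *_) (sym (sumFin-*ˡ n (2 ^ suc t) _)) ⟩
    k * sumFin n (λ v → 2 ^ suc t * 𝟙 (classB t v))   ≡⟨ sym (sumFin-*ˡ n k _) ⟩
    sumFin n (λ v → k * (2 ^ suc t * 𝟙 (classB t v))) ≡⟨ sumFin-cong n (λ v → trans
                                                          (cong (λ c → k * (2 ^ suc t * c)) (𝟙-∧ (not (side v)) _))
                                                          (reorder k (2 ^ suc t) (𝟙 (not (side v))) _)) ⟩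
    sumFin n (λ v → 𝟙 (not (side v)) * cost (deg G v) t) ∎
    where
    open ≡-Reasoning
    reorder : ∀ k M a b → k * (M * (a * b)) ≡ a * (k * M * b)
    reorder = solve-∀

  sumTo-classCost : ∀ T → sumTo (suc T) (λ t → k * (2 ^ suc t * classSize t)) ≤ 2 * k * sizeB + 8 * degSumB G side
  sumTo-classCost T = begin
    sumTo (suc T) (λ t → k * (2 ^ suc t * classSize t))
      ≡⟨ sumFin-cong (suc T) (λ i → classCost≡ (toℕ i)) ⟩
    sumTo (suc T) (λ t → sumFin n (λ v → 𝟙 (not (side v)) * cost (deg G v) t))
      ≡⟨ sumFin-swap (suc T) n (λ i v → 𝟙 (not (side v)) * cost (deg G v) (toℕ i)) ⟩
    sumFin n (λ v → sumTo (suc T) (λ t → 𝟙 (not (side v)) * cost (deg G v) t))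
      ≡⟨ sumFin-cong n (λ v → sumFin-*ˡ (suc T) (𝟙 (not (side v))) (λ i → cost (deg G v) (toℕ i))) ⟩
    sumFin n (λ v → 𝟙 (not (side v)) * sumTo (suc T) (cost (deg G v)))
      ≤⟨ sumFin-mono n (λ v → *-monoʳ-≤ (𝟙 (not (side v))) (sumTo-cost (deg G v) T)) ⟩
    sumFin n (λ v → 𝟙 (not (side v)) * (2 * k + 8 * deg G v))
      ≡⟨ sumFin-cong n (λ v → expand (𝟙 (not (side v))) k (deg G v)) ⟩
    sumFin n (λ v → 2 * k * 𝟙 (not (side v)) + 8 * (𝟙 (not (side v)) * deg G v))
      ≡⟨ trans (sumFin-+ n _ _) (cong₂ _+_ (sumFin-*ˡ n (2 * k) _) (sumFin-*ˡ n 8 _)) ⟩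
    2 * k * sizeB + 8 * degSumB G side ∎
    where
    open ≤-Reasoning
    expand : ∀ a k d → a * (2 * k + 8 * d) ≡ 2 * k * a + 8 * (a * d)
    expand = solve-∀

  sumTo-classSizes : ∀ T → 1 ≤ T →
    sumTo (suc T) (λ t → k * (sizeA + 2 ^ suc t * classSize t)) ≤ suc T * (k * n) + 8 * degSumB G side
  sumTo-classSizes T 1≤T = begin
    sumTo (suc T) (λ t → k * (sizeA + 2 ^ suc t * classSize t))
      ≡⟨ trans (sumFin-cong (suc T) (λ i → *-distribˡ-+ k sizeA (2 ^ suc (toℕ i) * classSize (toℕ i))))
               (sumFin-+ (suc T) (λ _ → k * sizeA) (λ i → k * (2 ^ suc (toℕ i) * classSize (toℕ i)))) ⟩
    sumTo (suc T) (λ _ → k * sizeA) + sumTo (suc T) (λ t → k * (2 ^ suc t * classSize t))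
      ≤⟨ +-mono-≤ (≤-reflexive (sumFin-const (suc T) (k * sizeA))) (sumTo-classCost T) ⟩
    suc T * (k * sizeA) + (2 * k * sizeB + 8 * degSumB G side)
      ≤⟨ +-monoʳ-≤ (suc T * (k * sizeA)) (+-monoˡ-≤ (8 * degSumB G side) (*-monoˡ-≤ sizeB (*-monoˡ-≤ k (s≤s 1≤T)))) ⟩
    suc T * (k * sizeA) + (suc T * k * sizeB + 8 * degSumB G side)
      ≡⟨ collect (suc T) k sizeA sizeB _ ⟩
    suc T * (k * (sizeA + sizeB)) + 8 * degSumB G side
      ≡⟨ cong (λ x → suc T * (k * x) + 8 * degSumB G side) sizeA+sizeB≡n ⟩
    suc T * (k * n) + 8 * degSumB G side ∎
    where
    open ≤-Reasoning
    collect : ∀ s k a b e → s * (k * a) + (s * k * b + e) ≡ s * (k * (a + b)) + e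
    collect = solve-∀

  degSumB≤sumTo-classDegSum : ∀ T → (∀ v → deg G v ≤ k * 2 ^ T) → degSumB G side ≤ sumTo (suc T) classDegSum
  degSumB≤sumTo-classDegSum T deg≤ = begin
    sumFin n (λ v → 𝟙 (not (side v)) * deg G v)
      ≤⟨ sumFin-mono n (λ v → ≤-trans (≤-reflexive (sym (*-identityʳ _)))
                                (*-monoʳ-≤ (𝟙 (not (side v)) * deg G v) (inSomeClass (deg G v) T (deg≤ v)))) ⟩
    sumFin n (λ v → 𝟙 (not (side v)) * deg G v * sumTo (suc T) (λ t → 𝟙 (inClass t (deg G v))))
      ≡⟨ sumFin-cong n (λ v → sym (trans (sumFin-cong (suc T) (λ i → per-class v (toℕ i))) (sumFin-*ˡ (suc T) (𝟙 (not (side v)) * deg G v) (λ i → 𝟙 (inClass (toℕ i) (deg G v)))))) ⟩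
    sumFin n (λ v → sumTo (suc T) (λ t → 𝟙 (classB t v) * deg G v))
      ≡⟨ sym (sumFin-swap (suc T) n (λ i v → 𝟙 (classB (toℕ i) v) * deg G v)) ⟩
    sumTo (suc T) classDegSum ∎
    where
    open ≤-Reasoning
    reorder : ∀ a b d → a * b * d ≡ a * d * b
    reorder = solve-∀
    per-class : ∀ v t → 𝟙 (classB t v) * deg G v ≡ 𝟙 (not (side v)) * deg G v * 𝟙 (inClass t (deg G v))
    per-class v t = trans (cong (_* deg G v) (𝟙-∧ (not (side v)) _)) (reorder (𝟙 (not (side v))) (𝟙 (inClass t (deg G v))) (deg G v))

  dense-colour-class : 8 ≤ k → ∀ T M → 1 ≤ T → (∀ v → deg G v ≤ k * 2 ^ T) →
    4 * (suc T * (k * n) + 8 * degSumB G side) < 3 * M * degSumB G side →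
    Σ ℕ λ t → Σ (Fin n → Fin (2 ^ suc t)) λ f → Σ (Fin (2 ^ suc t)) λ j →
      k * card (Colouring.S t f j) < M * degSum (Colouring.H t f j)
  dense-colour-class 8≤k T M 1≤T deg≤ dense =
    let (t , dense-class) = sumTo-<⇒∃< (suc T) (λ t → 4 * (k * (sizeA + 2 ^ suc t * classSize t)))
                                                (λ t → 3 * M * classDegSum t) dense-somewhere
        open ClassAverages t
        open Colouring t {m}
        (f , dense-f)     = sumMaps-<⇒∃< n m (λ f → sumFin m (λ j → k * card (S f j)))
                                             (λ f → sumFin m (λ j → M * degSum (H f j)))
                                             (dense-on-average 8≤k M dense-class)
        (j , dense-j)     = sumFin-<⇒∃< m (λ j → k * card (S f j)) (λ j → M * degSum (H f j)) dense-f
    in t , f , j , dense-j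
    where
    open ≤-Reasoning
    dense-somewhere : sumTo (suc T) (λ t → 4 * (k * (sizeA + 2 ^ suc t * classSize t)))
                    < sumTo (suc T) (λ t → 3 * M * classDegSum t)
    dense-somewhere = begin-strict
      sumTo (suc T) (λ t → 4 * (k * (sizeA + 2 ^ suc t * classSize t)))
        ≡⟨ sumFin-*ˡ (suc T) 4 (λ i → k * (sizeA + 2 ^ suc (toℕ i) * classSize (toℕ i))) ⟩
      4 * sumTo (suc T) (λ t → k * (sizeA + 2 ^ suc t * classSize t))
        ≤⟨ *-monoʳ-≤ 4 (sumTo-classSizes T 1≤T) ⟩
      4 * (suc T * (k * n) + 8 * degSumB G side)
        <⟨ dense ⟩
      3 * M * degSumB G side
        ≤⟨ *-monoʳ-≤ (3 * M) (degSumB≤sumTo-classDegSum T deg≤) ⟩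
      3 * M * sumTo (suc T) classDegSum
        ≡⟨ sym (sumFin-*ˡ (suc T) (3 * M) (λ i → classDegSum (toℕ i))) ⟩
      sumTo (suc T) (λ t → 3 * M * classDegSum t) ∎


  bounded-subgraph-of-dense-class : ∀ M → 2 ^ (4 * M) ≤ k ^ 400 →
    (Σ ℕ λ t → Σ (Fin n → Fin (2 ^ suc t)) λ f → Σ (Fin (2 ^ suc t)) λ j →
      k * card (Colouring.S t f j) < M * degSum (Colouring.H t f j)) →
    Σ (Fin n → Bool) λ S → Σ (Graph n) λ H →
      IsSubgraph G S H × 0 < card S × (∀ v → deg H v ≤ k) × LnGe k (k * card S) (400 * degSum H)
  bounded-subgraph-of-dense-class M 2^4M≤k^400 (t , f , j , dense) =
    S , H , H⊆S , card-positive G H S H⊆S (m<n*o⇒0<o (k * card S) M (degSum H) dense) , deg-H-≤ ,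
    LnGe-intro k M (degSum H) (k * card S) 2^4M≤k^400 dense
    where open Colouring t f j

power-of-two-between : ∀ k → 0 < k → Σ ℕ λ p → (k ≤ 2 ^ p) × (2 ^ p ≤ 2 * k)
power-of-two-between (suc zero) _ = 0 , ≤-refl , s≤s z≤n
power-of-two-between (suc (suc k)) _ with power-of-two-between (suc k) (s≤s z≤n)
... | p , k+1≤2^p , 2^p≤2k+2 with suc (suc k) ≤? 2 ^ p
... | yes k+2≤2^p = p , k+2≤2^p , ≤-trans 2^p≤2k+2 (*-monoʳ-≤ 2 (n≤1+n (suc k)))
... | no  k+2≰2^p = suc p ,
  subst (λ x → suc (suc k) ≤ 2 * x) (sym 2^p≡k+1) (s≤s k+1≤2k+1) ,
  subst (λ x → 2 * x ≤ 2 * suc (suc k)) (sym 2^p≡k+1) (*-monoʳ-≤ 2 (n≤1+n (suc k)))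
  where
  2^p≡k+1 : 2 ^ p ≡ suc k
  2^p≡k+1 = ≤-antisym (≤-pred (≰⇒> k+2≰2^p)) k+1≤2^p
  k+1≤2k+1 : suc k ≤ k + suc (k + 0)
  k+1≤2k+1 = subst (suc k ≤_) (sym (+-suc k (k + 0))) (s≤s (m≤m+n k (k + 0)))

k^7≤k*2^[6p+1] : ∀ k p → k ≤ 2 ^ p → k ^ 7 ≤ k * 2 ^ suc (6 * p)
k^7≤k*2^[6p+1] k p k≤2^p = *-monoʳ-≤ k (begin
  k ^ 6          ≤⟨ ^-monoˡ-≤ 6 k≤2^p ⟩
  (2 ^ p) ^ 6    ≡⟨ ^-*-assoc 2 p 6 ⟩
  2 ^ (p * 6)    ≡⟨ cong (2 ^_) (*-comm p 6) ⟩
  2 ^ (6 * p)    ≤⟨ ^-monoʳ-≤ 2 (n≤1+n (6 * p)) ⟩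
  2 ^ suc (6 * p) ∎)
  where open ≤-Reasoning

2^[4M]≤k^400 : ∀ k p → 8 ≤ k → 2 ^ p ≤ 2 * k → 2 ^ (4 * (64 * p + 33)) ≤ k ^ 400
2^[4M]≤k^400 k p 8≤k 2^p≤2k = begin
  2 ^ (4 * (64 * p + 33))      ≡⟨ cong (2 ^_) (exponent p) ⟩
  2 ^ (p * 256 + 132)          ≡⟨ ^-distribˡ-+-* 2 (p * 256) 132 ⟩
  2 ^ (p * 256) * 2 ^ 132      ≡⟨ cong (_* 2 ^ 132) (sym (^-*-assoc 2 p 256)) ⟩
  (2 ^ p) ^ 256 * 2 ^ 132      ≤⟨ *-monoˡ-≤ (2 ^ 132) (^-monoˡ-≤ 256 2^p≤2k) ⟩
  (2 * k) ^ 256 * 2 ^ 132      ≡⟨ cong (_* 2 ^ 132) (^-distribʳ-* 2 k 256) ⟩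
  2 ^ 256 * k ^ 256 * 2 ^ 132  ≡⟨ reorder (2 ^ 256) (k ^ 256) (2 ^ 132) ⟩
  2 ^ 256 * 2 ^ 132 * k ^ 256  ≡⟨ cong (_* k ^ 256) (sym (^-distribˡ-+-* 2 256 132)) ⟩
  2 ^ 388 * k ^ 256            ≤⟨ *-monoˡ-≤ (k ^ 256) 2^388≤8^144 ⟩
  8 ^ 144 * k ^ 256            ≤⟨ *-monoˡ-≤ (k ^ 256) (^-monoˡ-≤ 144 8≤k) ⟩
  k ^ 144 * k ^ 256            ≡⟨ sym (^-distribˡ-+-* k 144 256) ⟩
  k ^ 400                      ∎
  where
  open ≤-Reasoning
  2^388≤8^144 : 2 ^ 388 ≤ 8 ^ 144
  2^388≤8^144 = ≤-trans (^-monoʳ-≤ 2 (m≤m+n 388 44)) (≤-reflexive (sym (^-*-assoc 2 3 144)))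
  exponent : ∀ p → 4 * (64 * p + 33) ≡ p * 256 + 132
  exponent = solve-∀
  reorder : ∀ a b c → a * b * c ≡ a * c * b
  reorder = solve-∀

kn≤8e⇒0<e : ∀ k n e → 0 < k → 0 < n → k * n ≤ 8 * e → 0 < e
kn≤8e⇒0<e k n zero    0<k 0<n kn≤0 = ⊥-elim (n≮0 (≤-trans (*-mono-≤ 0<k 0<n) kn≤0))
kn≤8e⇒0<e k n (suc e) _   _   _    = s≤s z≤n

class-count-condition : ∀ p k n e → 0 < e → k * n ≤ 8 * e →
  4 * (suc (suc (6 * p)) * (k * n) + 8 * e) < 3 * (64 * p + 33) * e
class-count-condition p k n e 0<e kn≤8e = begin-strict
  4 * (suc (suc (6 * p)) * (k * n) + 8 * e)
    ≤⟨ *-monoʳ-≤ 4 (+-monoˡ-≤ (8 * e) (*-monoʳ-≤ (suc (suc (6 * p))) kn≤8e)) ⟩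
  4 * (suc (suc (6 * p)) * (8 * e) + 8 * e)
    ≡⟨ expand p e ⟩
  (192 * p + 96) * e
    <⟨ *-monoˡ-< e {{>-nonZero 0<e}} (+-monoʳ-< (192 * p) (m≤m+n 97 2)) ⟩
  (192 * p + 99) * e
    ≡⟨ collect p e ⟩
  3 * (64 * p + 33) * e ∎
  where
  open ≤-Reasoning
  expand : ∀ p e → 4 * (suc (suc (6 * p)) * (8 * e) + 8 * e) ≡ (192 * p + 96) * e
  expand = solve-∀
  collect : ∀ p e → (192 * p + 99) * e ≡ 3 * (64 * p + 33) * e
  collect = solve-∀

lemma3p2 : Σ ℕ λ K → ∀ k → K ≤ k →
    ∀ n (G : Graph n) (side : Fin n → Bool) →
    IsBipartition G side →
    0 < n →
    (∀ v → deg G v ≤ k ^ 7) →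
    k * n ≤ 4 * degSum G →
    (∀ v → side v ≡ true → deg G v ≤ k) →
    Σ (Fin n → Bool) λ S → Σ (Graph n) λ H →
    IsSubgraph G S H × 0 < card S ×
    (∀ v → deg H v ≤ k) ×
    LnGe k (k * card S) (400 * degSum H)
lemma3p2 = 8 , λ k 8≤k n G side bip 0<n Δ≤k⁷ kn≤4degSum A-deg≤k →
  let open Construction k G side bip A-deg≤k
      0<k                  = ≤-trans (s≤s z≤n) 8≤k
      (p , k≤2^p , 2^p≤2k) = power-of-two-between k 0<k
      e                    = degSumB G side
      kn≤8e                = ≤-trans kn≤4degSum
                               (≤-reflexive (trans (cong (4 *_) (degSum≡2*degSumB G side bip)) (sym (*-assoc 4 2 e))))
  in bounded-subgraph-of-dense-class (64 * p + 33) (2^[4M]≤k^400 k p 8≤k 2^p≤2k)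
       (dense-colour-class 8≤k (suc (6 * p)) (64 * p + 33) (s≤s z≤n)
         (λ v → ≤-trans (Δ≤k⁷ v) (k^7≤k*2^[6p+1] k p k≤2^p))
         (class-count-condition p k n e (kn≤8e⇒0<e k n e 0<k 0<n kn≤8e) kn≤8e))
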